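{- Work in Bishop-style constructive mathematics (intuitionistic logic, with countable/dependent choice). For $n \geq 1$ define $f_n : [0,1] \to \mathbb{R}$ by $$f_n(x) = \begin{cases} 2nx & \text{if } x \in [0, \tfrac{1}{2n}], \\ 2 - 2nx & \text{if } x \in [\tfrac{1}{2n}, \tfrac{2}{2n}], \\ 0 & \text{if } x \in [\tfrac{2}{2n}, 1]. \end{cases}$$ Then LPO holds if and only if $(f_n)_{n\ge 1}$ converges point-wise to $0$ on $[0,1]$, i.e. for every $x \in [0,1]$, $f_n(x) \to 0$.
   Context: The limited principle of omniscience (LPO) is the statement: for every binary sequence $(a_n)_{n \geq 1}$, either $a_n = 0$ for all $n$, or there exists $n$ with $a_n = 1$. All reasoning is constructive (intuitionistic logic), with countable and dependent choice available. -}

module Defs where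

open import Data.Bool using (Bool; true; false)
open import Data.Nat as ℕ using (ℕ; suc; _∸_)
open import Data.Integer as ℤ using (+_)
open import Data.Rational using (ℚ; 0ℚ; 1ℚ; _≤_; _+_; _-_; _*_; _⊔_; _⊓_; ∣_∣; _/_)
open import Data.Product using (Σ; _×_; ∃; ∃-syntax)
open import Data.Sum using (_⊎_)
open import Relation.Binary.PropositionalEquality using (_≡_)

LPO : Set
LPO = (a : ℕ → Bool) → ((n : ℕ) → a n ≡ false) ⊎ (∃[ n ] a n ≡ true)

-- Bishop reals: regular sequences of rationals.
-- Index m stands for Bishop's index m+1, i.e. precision 1/(m+1).

inv : ℕ → ℚ
inv m = + 1 / suc m

record ℝ : Set where
  field
    seq : ℕ → ℚ
    reg : ∀ m n → ∣ seq m - seq n ∣ ≤ inv m + inv n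
open ℝ public

_≤ₛ_ : (ℕ → ℚ) → (ℕ → ℚ) → Set
a ≤ₛ b = ∀ m → a m ≤ b m + (inv m + inv m)

const : ℚ → (ℕ → ℚ)
const q = λ _ → q

absₛ : (ℕ → ℚ) → (ℕ → ℚ)
absₛ a m = ∣ a m ∣

In01 : ℝ → Set
In01 x = (const 0ℚ ≤ₛ seq x) × (seq x ≤ₛ const 1ℚ)

-- The functions f_n, n ≥ 1.  We write n = suc k.
-- On rationals:  g_n(q) = max(0, min(2nq, 2 - 2nq)),
-- which agrees with the paper's piecewise formula on [0,1]
-- and is 2n-Lipschitz.

g : ℕ → ℚ → ℚ
g n q = 0ℚ ⊔ ((c * q) ⊓ ((+ 2 / 1) - c * q))
  where c = + (2 ℕ.* n) / 1

-- The (regular) sequence of the real number f_{suc k}(x):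
-- m-th term = g_n(x at precision 1/(2n(m+1))).
f : (k : ℕ) → ℝ → (ℕ → ℚ)
f k x m = g n (seq x ((2 ℕ.* n ℕ.* suc m) ∸ 1))
  where n = suc k

ConvergesToZero : ℝ → Set
ConvergesToZero x =
  ∀ (j : ℕ) → ∃[ N ] ∀ (k : ℕ) → N ℕ.≤ k → absₛ (f k x) ≤ₛ const (inv j)

PointwiseToZero : Set
PointwiseToZero = ∀ (x : ℝ) → In01 x → ConvergesToZero x

-- Given x, LPO decides whether x_n ≤ 2/n for every n, so that x ≤ 0, or
-- 2/p < x_p for some p, so that x > 1/p.  In the first case every f_n
-- vanishes at x; in the second f_n(x) = 0 for n ≥ p, because f_n is
-- supported on [0, 1/n].  Conversely, a binary sequence a is encoded by the
-- point x = 1/(2n) at the peak of f_n, where a_n is the first 1 of a, and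
-- x = 0 if there is none; x is a regular sequence since a late first 1 only
-- moves it by little.  Convergence with ε = 1/2 gives N: either a has a 1
-- up to N, or a 1 anywhere would make its first 1 come after N and force
-- f_n(x) = 1 for some n > N, so a vanishes.
module Submission where

open import Defs
open import Data.Product using (_×_)

open import Data.Bool using (Bool; true; false)
open import Data.Empty using (⊥-elim)
open import Data.Integer as ℤ using (+_)
import Data.Integer.Properties as ℤₚ
open import Data.Nat as ℕ using (ℕ; zero; suc; z≤n; s≤s; _∸_)
import Data.Nat.Properties as ℕₚ
open import Data.Nat.Tactic.RingSolver using (solve-∀)
open import Data.Product using (_,_; ∃)
open import Data.Rational
open import Data.Rational.Properties
open import Data.Rational.Solver using (module +-*-Solver)
import Data.Rational.Unnormalised as ℚᵘ
import Data.Rational.Unnormalised.Properties as ℚᵘₚ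
open import Data.Sum using (_⊎_; inj₁; inj₂)
open import Relation.Binary.Definitions using (tri<; tri≈; tri>)
open import Relation.Binary.PropositionalEquality
open import Relation.Nullary using (¬_; does; proof; from-no)
open import Relation.Nullary.Reflects using (Reflects; invert)
open import Relation.Unary using (Decidable)

toℚᵘ-/ : ∀ i d → toℚᵘ (i / suc d) ℚᵘ.≃ ℚᵘ.mkℚᵘ i d
toℚᵘ-/ i d = toℚᵘ-fromℚᵘ (ℚᵘ.mkℚᵘ i d)

+-*-+ : ∀ a b → + a ℤ.* + b ≡ + (a ℕ.* b)
+-*-+ a b = sym (ℤₚ.pos-* a b)

/-≡ : ∀ a b c d → a ℕ.* suc d ≡ c ℕ.* suc b → + a / suc b ≡ + c / suc d
/-≡ a b c d eq = toℚᵘ-injective (ℚᵘₚ.≃-trans (toℚᵘ-/ (+ a) b)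
  (ℚᵘₚ.≃-trans (ℚᵘ.*≡* cross) (ℚᵘₚ.≃-sym (toℚᵘ-/ (+ c) d))))
  where
  cross : + a ℤ.* + suc d ≡ + c ℤ.* + suc b
  cross = trans (+-*-+ a (suc d)) (trans (cong +_ eq) (sym (+-*-+ c (suc b))))

/-≤ : ∀ a b c d → a ℕ.* suc d ℕ.≤ c ℕ.* suc b → + a / suc b ≤ + c / suc d
/-≤ a b c d le = toℚᵘ-cancel-≤ (ℚᵘₚ.≤-respˡ-≃ (ℚᵘₚ.≃-sym (toℚᵘ-/ (+ a) b))
  (ℚᵘₚ.≤-respʳ-≃ (ℚᵘₚ.≃-sym (toℚᵘ-/ (+ c) d)) (ℚᵘ.*≤* cross)))
  where
  cross : + a ℤ.* + suc d ℤ.≤ + c ℤ.* + suc b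
  cross = subst₂ ℤ._≤_ (sym (+-*-+ a (suc d))) (sym (+-*-+ c (suc b))) (ℤ.+≤+ le)

/-*-/ : ∀ a b c d → (+ a / suc b) * (+ c / suc d) ≡ + (a ℕ.* c) / (suc b ℕ.* suc d)
/-*-/ a b c d = toℚᵘ-injective (ℚᵘₚ.≃-trans (toℚᵘ-homo-* (+ a / suc b) (+ c / suc d))
  (ℚᵘₚ.≃-trans (ℚᵘₚ.*-cong (toℚᵘ-/ (+ a) b) (toℚᵘ-/ (+ c) d))
    (ℚᵘₚ.≃-sym (ℚᵘₚ.≃-trans (toℚᵘ-/ (+ (a ℕ.* c)) (d ℕ.+ b ℕ.* suc d))
      (ℚᵘ.*≡* (cong (ℤ._* + (suc b ℕ.* suc d)) (sym (+-*-+ a c))))))))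

/-*-/-≡ : ∀ a b c d e f → a ℕ.* c ℕ.* suc f ≡ e ℕ.* (suc b ℕ.* suc d) →
          (+ a / suc b) * (+ c / suc d) ≡ + e / suc f
/-*-/-≡ a b c d e f eq = trans (/-*-/ a b c d) (/-≡ (a ℕ.* c) (d ℕ.+ b ℕ.* suc d) e f eq)

inv-nonNeg : ∀ m → 0ℚ ≤ inv m
inv-nonNeg m = /-≤ 0 0 1 m z≤n

inv-antitone : ∀ {m n} → m ℕ.≤ n → inv n ≤ inv m
inv-antitone {m} {n} m≤n = /-≤ 1 n 1 m (ℕₚ.*-monoʳ-≤ 1 (s≤s m≤n))

0≤inv+inv : ∀ m n → 0ℚ ≤ inv m + inv n
0≤inv+inv m n = +-mono-≤ (inv-nonNeg m) (inv-nonNeg n)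

slope : ℕ → ℚ
slope k = + (2 ℕ.* suc k) / 1

slope-nonNeg : ∀ k → NonNegative (slope k)
slope-nonNeg k = normalize-nonNeg (2 ℕ.* suc k) 1

sampleIndex : ℕ → ℕ → ℕ
sampleIndex k m = 2 ℕ.* suc k ℕ.* suc m ∸ 1

i≤sampleIndex : ∀ i m → i ℕ.≤ sampleIndex i m
i≤sampleIndex i m = ℕₚ.∸-monoˡ-≤ 1 (ℕₚ.≤-trans (ℕₚ.m≤n*m (suc i) 2) (ℕₚ.m≤m*n (2 ℕ.* suc i) (suc m)))

peak : ℕ → ℚ
peak k = + 1 / (2 ℕ.* suc k)

slope*inv-sampleIndex : ∀ k m → slope k * inv (sampleIndex k m) ≡ inv m
slope*inv-sampleIndex k m = /-*-/-≡ (2 ℕ.* suc k) 0 1 (sampleIndex k m) 1 m (lemma k m)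
  where
  lemma : ∀ k m → 2 ℕ.* suc k ℕ.* 1 ℕ.* suc m ≡ 1 ℕ.* (1 ℕ.* (2 ℕ.* suc k ℕ.* suc m))
  lemma = solve-∀

slope*inv : ∀ k → slope k * inv k ≡ + 2 / 1
slope*inv k = /-*-/-≡ (2 ℕ.* suc k) 0 1 k 2 0 (lemma k)
  where
  lemma : ∀ k → 2 ℕ.* suc k ℕ.* 1 ℕ.* 1 ≡ 2 ℕ.* (1 ℕ.* suc k)
  lemma = solve-∀

slope*peak : ∀ k → slope k * peak k ≡ 1ℚ
slope*peak k = /-*-/-≡ (2 ℕ.* suc k) 0 1 _ 1 0 (lemma k)
  where
  lemma : ∀ k → 2 ℕ.* suc k ℕ.* 1 ℕ.* 1 ≡ 1 ℕ.* (1 ℕ.* (2 ℕ.* suc k))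
  lemma = solve-∀

p≤∣p∣ : ∀ p → p ≤ ∣ p ∣
p≤∣p∣ p with ∣p∣≡p∨∣p∣≡-p p
... | inj₁ ∣p∣≡p = ≤-reflexive (sym ∣p∣≡p)
... | inj₂ ∣p∣≡-p = ≤-trans p≤0 (0≤∣p∣ p)
  where
  neg-involutive : ∀ p → - (- p) ≡ p
  neg-involutive = solve 1 (λ p → :- (:- p) := p) refl
    where open +-*-Solver
  p≤0 : p ≤ 0ℚ
  p≤0 = subst (_≤ 0ℚ) (neg-involutive p) (neg-antimono-≤ (subst (0ℚ ≤_) ∣p∣≡-p (0≤∣p∣ p)))

p≤p+q : ∀ {p q} → 0ℚ ≤ q → p ≤ p + q
p≤p+q {p} {q} 0≤q = subst (_≤ p + q) (+-identityʳ p) (+-monoʳ-≤ p 0≤q)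

q≤p+q : ∀ {p q} → 0ℚ ≤ p → q ≤ p + q
q≤p+q {p} {q} 0≤p = subst (_≤ p + q) (+-identityˡ q) (+-monoˡ-≤ q 0≤p)

p-q≤r⇒p-r≤q : ∀ {p q r} → p - q ≤ r → p - r ≤ q
p-q≤r⇒p-r≤q {p} {q} {r} p-q≤r = begin
  p - r             ≡⟨ regroup p q r ⟩
  (p - q) - r + q   ≤⟨ +-monoˡ-≤ q (+-monoˡ-≤ (- r) p-q≤r) ⟩
  r - r + q         ≡⟨ cong (_+ q) (+-inverseʳ r) ⟩
  0ℚ + q            ≡⟨ +-identityˡ q ⟩
  q                 ∎
  where
  open ≤-Reasoning
  open +-*-Solver
  regroup : ∀ p q r → p - r ≡ (p - q) - r + q
  regroup = solve 3 (λ p q r → p :- r := (p :- q) :- r :+ q) refl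

seq-lowerBound : ∀ x m n → seq x m - (inv m + inv n) ≤ seq x n
seq-lowerBound x m n = p-q≤r⇒p-r≤q {seq x m} (≤-trans (p≤∣p∣ _) (reg x m n))

≤ₛ0-intro : ∀ {a} → (∀ m → a m ≤ inv m + inv m) → a ≤ₛ const 0ℚ
≤ₛ0-intro {a} a≤ m = subst (a m ≤_) (sym (+-identityˡ (inv m + inv m))) (a≤ m)

≤ₛ0-elim : ∀ {a} → a ≤ₛ const 0ℚ → ∀ m → a m ≤ inv m + inv m
≤ₛ0-elim {a} a≤0 m = subst (a m ≤_) (+-identityˡ (inv m + inv m)) (a≤0 m)

0≤g : ∀ n q → 0ℚ ≤ g n q
0≤g n q = p≤p⊔q 0ℚ ((c * q) ⊓ (+ 2 / 1 - c * q))
  where c = + (2 ℕ.* n) / 1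

g≤-rising : ∀ k q {b} → 0ℚ ≤ b → slope k * q ≤ b → g (suc k) q ≤ b
g≤-rising k q 0≤b h = ⊔-lub 0≤b (≤-trans (p⊓q≤p (slope k * q) (+ 2 / 1 - slope k * q)) h)

g≤-falling : ∀ k q {b} → 0ℚ ≤ b → + 2 / 1 - slope k * q ≤ b → g (suc k) q ≤ b
g≤-falling k q 0≤b h = ⊔-lub 0≤b (≤-trans (p⊓q≤q (slope k * q) (+ 2 / 1 - slope k * q)) h)

f≤ₛ0⇒∣f∣≤ₛinv : ∀ k x j → f k x ≤ₛ const 0ℚ → absₛ (f k x) ≤ₛ const (inv j)
f≤ₛ0⇒∣f∣≤ₛinv k x j f≤0 m = begin
  ∣ f k x m ∣               ≡⟨ 0≤p⇒∣p∣≡p (0≤g (suc k) (seq x (sampleIndex k m))) ⟩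
  f k x m                   ≤⟨ f≤0 m ⟩
  0ℚ + (inv m + inv m)      ≤⟨ +-monoˡ-≤ (inv m + inv m) (inv-nonNeg j) ⟩
  inv j + (inv m + inv m)   ∎
  where open ≤-Reasoning

f≤ₛ0-left : ∀ k x → seq x ≤ₛ const 0ℚ → f k x ≤ₛ const 0ℚ
f≤ₛ0-left k x x≤0 = ≤ₛ0-intro λ m → g≤-rising k _ (0≤inv+inv m m) (rising m)
  where
  open ≤-Reasoning
  rising : ∀ m → slope k * seq x (sampleIndex k m) ≤ inv m + inv m
  rising m = begin
    slope k * seq x M                  ≤⟨ *-monoˡ-≤-nonNeg (slope k) {{slope-nonNeg k}} (≤ₛ0-elim x≤0 M) ⟩
    slope k * (inv M + inv M)          ≡⟨ *-distribˡ-+ (slope k) (inv M) (inv M) ⟩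
    slope k * inv M + slope k * inv M  ≡⟨ cong₂ _+_ (slope*inv-sampleIndex k m) (slope*inv-sampleIndex k m) ⟩
    inv m + inv m                      ∎
    where M = sampleIndex k m

f≤ₛ0-right : ∀ {p} k x → p ℕ.≤ k → inv p + inv p < seq x p → f k x ≤ₛ const 0ℚ
f≤ₛ0-right {p} k x p≤k 2/p<x = ≤ₛ0-intro λ m →
  g≤-falling k _ (0≤inv+inv m m) (≤-trans (falling m) (p≤p+q (inv-nonNeg m)))
  where
  open ≤-Reasoning
  open +-*-Solver
  halve : ∀ p q → p - q ≡ (p + p) - (p + q)
  halve = solve 2 (λ p q → p :- q := (p :+ p) :- (p :+ q)) refl
  factor : ∀ c p q → c * p - c * q ≡ c * (p - q)
  factor = solve 3 (λ c p q → c :* p :- c :* q := c :* (p :- q)) refl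
  falling : ∀ m → + 2 / 1 - slope k * seq x (sampleIndex k m) ≤ inv m
  falling m = p-q≤r⇒p-r≤q {+ 2 / 1} (begin
    + 2 / 1 - inv m                  ≡⟨ cong₂ _-_ (sym (slope*inv k)) (sym (slope*inv-sampleIndex k m)) ⟩
    slope k * inv k - slope k * inv M ≤⟨ +-monoˡ-≤ _ (*-monoˡ-≤-nonNeg (slope k) {{slope-nonNeg k}} (inv-antitone p≤k)) ⟩
    slope k * inv p - slope k * inv M ≡⟨ factor (slope k) (inv p) (inv M) ⟩
    slope k * (inv p - inv M)         ≤⟨ *-monoˡ-≤-nonNeg (slope k) {{slope-nonNeg k}} x-close ⟩
    slope k * seq x M                 ∎)
    where
    M = sampleIndex k m
    x-close : inv p - inv M ≤ seq x M
    x-close = begin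
      inv p - inv M                  ≡⟨ halve (inv p) (inv M) ⟩
      (inv p + inv p) - (inv p + inv M) ≤⟨ +-monoˡ-≤ _ (<⇒≤ 2/p<x) ⟩
      seq x p - (inv p + inv M)      ≤⟨ seq-lowerBound x p M ⟩
      seq x M                        ∎

LPO⇒decide : LPO → ∀ {P : ℕ → Set} → Decidable P → (∀ n → ¬ P n) ⊎ ∃ P
LPO⇒decide lpo P? with lpo (λ n → does (P? n))
... | inj₁ never = inj₁ λ n → invert (subst (Reflects _) (never n) (proof (P? n)))
... | inj₂ (n , hit) = inj₂ (n , invert (subst (Reflects _) hit (proof (P? n))))

LPO⇒PointwiseToZero : LPO → PointwiseToZero
LPO⇒PointwiseToZero lpo x _ j with LPO⇒decide lpo (λ n → inv n + inv n <? seq x n)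
... | inj₁ x≤0 = 0 , λ k _ → f≤ₛ0⇒∣f∣≤ₛinv k x j (f≤ₛ0-left k x (≤ₛ0-intro λ m → ≮⇒≥ (x≤0 m)))
... | inj₂ (p , 2/p<x) = p , λ k p≤k → f≤ₛ0⇒∣f∣≤ₛinv k x j (f≤ₛ0-right k x p≤k 2/p<x)

true≢false : true ≢ false
true≢false ()

Least : (ℕ → Bool) → ℕ → Set
Least a i = a i ≡ true × (∀ {j} → j ℕ.< i → a j ≡ false)

Least-unique : ∀ {a i j} → Least a i → Least a j → i ≡ j
Least-unique {i = i} {j} (ai , below-i) (aj , below-j) with ℕₚ.<-cmp i j
... | tri< i<j _ _ = ⊥-elim (true≢false (trans (sym ai) (below-j i<j)))
... | tri≈ _ i≡j _ = i≡j
... | tri> _ _ j<i = ⊥-elim (true≢false (trans (sym aj) (below-i j<i)))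

Misses : (ℕ → Bool) → ℕ → Set
Misses a m = ∀ {j} → j ℕ.≤ m → a j ≡ false

Misses-suc : ∀ {a m} → Misses a m → a (suc m) ≡ false → Misses a (suc m)
Misses-suc misses am j≤1+m with ℕₚ.m≤n⇒m<n∨m≡n j≤1+m
... | inj₁ (s≤s j≤m) = misses j≤m
... | inj₂ refl = am

Misses⇒Least-beyond : ∀ {a m i} → Misses a m → Least a i → m ℕ.< i
Misses⇒Least-beyond misses (ai , _) = ℕₚ.≰⇒> λ i≤m → true≢false (trans (sym ai) (misses i≤m))

data Search (a : ℕ → Bool) (m : ℕ) : Set where
  miss : Misses a m → Search a m
  hit  : ∀ {i} → i ℕ.≤ m → Least a i → Search a m

search : ∀ a m → Search a m
search a zero with a 0 in a0
... | true = hit z≤n (a0 , λ ())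
... | false = miss λ { z≤n → a0 }
search a (suc m) with search a m
... | hit i≤m least = hit (ℕₚ.m≤n⇒m≤1+n i≤m) least
... | miss misses with a (suc m) in am
...   | true = hit ℕₚ.≤-refl (am , λ j<1+m → misses (ℕ.s≤s⁻¹ j<1+m))
...   | false = miss (Misses-suc misses am)

Least-exists : ∀ {a n} → a n ≡ true → ∃ (Least a)
Least-exists {a} {n} an with search a n
... | miss misses = ⊥-elim (true≢false (trans (sym an) (misses ℕₚ.≤-refl)))
... | hit _ least = _ , least

peak-nonNeg : ∀ k → 0ℚ ≤ peak k
peak-nonNeg k = nonNegative⁻¹ (peak k) {{normalize-nonNeg 1 (2 ℕ.* suc k)}}

peak≤inv : ∀ k → peak k ≤ inv k
peak≤inv k = /-≤ 1 _ 1 k (ℕₚ.*-monoʳ-≤ 1 (ℕₚ.m≤n*m (suc k) 2))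

peak≤inv-below : ∀ {m k} → m ℕ.< k → peak k ≤ inv m
peak≤inv-below {m} {k} m<k = ≤-trans (peak≤inv k) (inv-antitone (ℕₚ.<⇒≤ m<k))

g-peak : ∀ k → g (suc k) (peak k) ≡ 1ℚ
g-peak k = cong (λ y → 0ℚ ⊔ (y ⊓ (+ 2 / 1 - y))) (slope*peak k)

searchValue : ∀ {a m} → Search a m → ℚ
searchValue (miss _) = 0ℚ
searchValue (hit {i} _ _) = peak i

searchValue-hit : ∀ {a m i} → Least a i → i ℕ.≤ m → (s : Search a m) → searchValue s ≡ peak i
searchValue-hit (ai , _) i≤m (miss misses) = ⊥-elim (true≢false (trans (sym ai) (misses i≤m)))
searchValue-hit least _ (hit _ least′) = cong peak (Least-unique least′ least)

searchValue-nonNeg : ∀ {a m} (s : Search a m) → 0ℚ ≤ searchValue s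
searchValue-nonNeg (miss _) = ≤-refl
searchValue-nonNeg (hit {i} _ _) = peak-nonNeg i

searchValue≤1 : ∀ {a m} (s : Search a m) → searchValue s ≤ 1ℚ
searchValue≤1 (miss _) = inv-nonNeg 0
searchValue≤1 (hit {i} _ _) = ≤-trans (peak≤inv i) (inv-antitone {0} {i} z≤n)

∣0-p∣≡p : ∀ {p} → 0ℚ ≤ p → ∣ 0ℚ - p ∣ ≡ p
∣0-p∣≡p {p} 0≤p = trans (cong ∣_∣ (+-identityˡ (- p))) (trans (∣-p∣≡∣p∣ p) (0≤p⇒∣p∣≡p 0≤p))

∣p-0∣≡p : ∀ {p} → 0ℚ ≤ p → ∣ p - 0ℚ ∣ ≡ p
∣p-0∣≡p {p} 0≤p = trans (cong ∣_∣ (+-identityʳ p)) (0≤p⇒∣p∣≡p 0≤p)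

searchValue-regular : ∀ {a m n} (s : Search a m) (t : Search a n) →
                      ∣ searchValue s - searchValue t ∣ ≤ inv m + inv n
searchValue-regular {m = m} {n} (miss _) (miss _) = 0≤inv+inv m n
searchValue-regular {m = m} {n} (miss misses) (hit {i} _ least) = begin
  ∣ 0ℚ - peak i ∣  ≡⟨ ∣0-p∣≡p (peak-nonNeg i) ⟩
  peak i          ≤⟨ peak≤inv-below (Misses⇒Least-beyond misses least) ⟩
  inv m           ≤⟨ p≤p+q (inv-nonNeg n) ⟩
  inv m + inv n   ∎
  where open ≤-Reasoning
searchValue-regular {m = m} {n} (hit {i} _ least) (miss misses) = begin
  ∣ peak i - 0ℚ ∣  ≡⟨ ∣p-0∣≡p (peak-nonNeg i) ⟩
  peak i          ≤⟨ peak≤inv-below (Misses⇒Least-beyond misses least) ⟩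
  inv n           ≤⟨ q≤p+q (inv-nonNeg m) ⟩
  inv m + inv n   ∎
  where open ≤-Reasoning
searchValue-regular {m = m} {n} (hit {i} _ least) (hit {j} _ least′) = begin
  ∣ peak i - peak j ∣  ≡⟨ cong (λ k → ∣ peak i - peak k ∣) (Least-unique least′ least) ⟩
  ∣ peak i - peak i ∣  ≡⟨ cong ∣_∣ (+-inverseʳ (peak i)) ⟩
  0ℚ                  ≤⟨ 0≤inv+inv m n ⟩
  inv m + inv n       ∎
  where open ≤-Reasoning

hitPoint : (ℕ → Bool) → ℝ
hitPoint a = record
  { seq = λ m → searchValue (search a m)
  ; reg = λ m n → searchValue-regular (search a m) (search a n)
  }

hitPoint-In01 : ∀ a → In01 (hitPoint a)
hitPoint-In01 a =
  (λ m → +-mono-≤ (searchValue-nonNeg (search a m)) (0≤inv+inv m m)) ,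
  (λ m → ≤-trans (searchValue≤1 (search a m)) (p≤p+q (0≤inv+inv m m)))

f-hitPoint-firstHit : ∀ {a i} → Least a i → ∀ m → f i (hitPoint a) m ≡ 1ℚ
f-hitPoint-firstHit {a} {i} least m =
  trans (cong (g (suc i)) (searchValue-hit least (i≤sampleIndex i m) (search a (sampleIndex i m))))
        (g-peak i)

-- At precision index 4 the Bishop order would give 1 ≤ 1/2 + 2/5.
≡1⇒¬∣∣≤ₛ½ : ∀ {a} → (∀ m → a m ≡ 1ℚ) → ¬ (absₛ a ≤ₛ const (inv 1))
≡1⇒¬∣∣≤ₛ½ a≡1 ∣a∣≤½ =
  from-no (∣ 1ℚ ∣ ≤? inv 1 + (inv 4 + inv 4)) (subst (λ y → ∣ y ∣ ≤ inv 1 + (inv 4 + inv 4)) (a≡1 4) (∣a∣≤½ 4))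

PointwiseToZero⇒LPO : PointwiseToZero → LPO
PointwiseToZero⇒LPO pw a with pw (hitPoint a) (hitPoint-In01 a) 1
... | N , ∣f∣≤½ with search a N
...   | hit _ (ai , _) = inj₂ (_ , ai)
...   | miss misses = inj₁ never
  where
  never : ∀ n → a n ≡ false
  never n with a n in an
  ... | false = refl
  ... | true with Least-exists an
  ...   | i , least = ⊥-elim (≡1⇒¬∣∣≤ₛ½ (f-hitPoint-firstHit least)
                               (∣f∣≤½ i (ℕₚ.<⇒≤ (Misses⇒Least-beyond misses least))))

proposition3 : (LPO → PointwiseToZero) × (PointwiseToZero → LPO)
proposition3 = LPO⇒PointwiseToZero , PointwiseToZero⇒LPO
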